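{- Let $G$ be a graph with $|V(G)|=n$ and maximum degree $\Delta(G)=d<\frac n2 -1$. Then for every integer $q\geq \frac{d}{\ln(n/(2d+2))}$, in the $(1,q)$ Avoider-Enforcer game played on $E(G)$ according to the monotone rules, Avoider has a strategy ensuring that at the end of the game some vertex of $G$ is incident to none of the edges claimed by Avoider.
   Context: In a $(p,q)$ Avoider-Enforcer game on the board $E(G)$ played according to the monotone rules, Avoider and Enforcer alternately claim at least $p$ and at least $q$ previously unclaimed edges of $G$ per move, respectively; if fewer than $p$ (resp. $q$) unclaimed edges remain before Avoider's (resp. Enforcer's) move, he claims all of them. The game ends when all edges are claimed. -}

module Defs where

open import Data.Nat using (ℕ; zero; suc; _+_; _*_; _^_; _≤_; _<_; _⊓_)
open import Data.Fin using (Fin)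
open import Data.Fin.Subset using (Subset; _∈_; _∉_; _⊆_; _∪_; _─_; ∣_∣; Nonempty; Empty; ⊥; ⊤)
open import Data.Product using (Σ; ∃; _×_; _,_; proj₁; proj₂)
open import Data.Sum using (_⊎_)
open import Data.List using (length; filter)
open import Data.List.Base using (allFin)
open import Relation.Binary.PropositionalEquality using (_≡_; _≢_)
open import Relation.Nullary using (¬_; Dec)
open import Data.Fin using (_≟_)
open import Relation.Nullary.Decidable using (_⊎-dec_)

-- A finite simple graph on vertex set Fin n, with edge set E(G) indexed by Fin m:
-- edge e has endpoints ends e = (u , v), u ≠ v, and distinct indices give
-- distinct unordered pairs.
record Graph (n : ℕ) : Set where
  field
    m        : ℕ
    ends     : Fin m → Fin n × Fin n
    loopless : ∀ e → proj₁ (ends e) ≢ proj₂ (ends e)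
    simple   : ∀ e f →
      ((proj₁ (ends e) ≡ proj₁ (ends f)) × (proj₂ (ends e) ≡ proj₂ (ends f)))
      ⊎ ((proj₁ (ends e) ≡ proj₂ (ends f)) × (proj₂ (ends e) ≡ proj₁ (ends f)))
      → e ≡ f

module _ {n : ℕ} (G : Graph n) where
  open Graph G

  Incident : Fin n → Fin m → Set
  Incident v e = (v ≡ proj₁ (ends e)) ⊎ (v ≡ proj₂ (ends e))

  incident? : ∀ v e → Dec (Incident v e)
  incident? v e = (v ≟ proj₁ (ends e)) ⊎-dec (v ≟ proj₂ (ends e))

  degree : Fin n → ℕ
  degree v = length (filter (incident? v) (allFin m))

  MaxDegree : ℕ → Set
  MaxDegree d = (∀ v → degree v ≤ d) × (∃ λ v → degree v ≡ d)

  AvoiderGoal : Subset m → Set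
  AvoiderGoal A = ∃ λ v → ∀ e → e ∈ A → ¬ Incident v e

  LegalMove : ℕ → Subset m → Subset m → Set
  LegalMove p F M = M ⊆ F × (p ⊓ ∣ F ∣) ≤ ∣ M ∣

  -- A position is (A , F):
  -- A = edges claimed by Avoider so far, F = unclaimed edges.
  -- AvoiderTurnWin p q A F : Avoider, about to move, has a strategy guaranteeing
  -- AvoiderGoal at the end of the game; EnforcerTurnWin likewise with Enforcer
  -- about to move.  (Enforcer's claimed edges do not affect the goal.)
  mutual
    data AvoiderTurnWin (p q : ℕ) : Subset m → Subset m → Set where
      a-end  : ∀ {A F} → Empty F → AvoiderGoal A → AvoiderTurnWin p q A F
      a-move : ∀ {A F} → Nonempty F → (M : Subset m) → LegalMove p F M →
               EnforcerTurnWin p q (A ∪ M) (F ─ M) → AvoiderTurnWin p q A F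

    data EnforcerTurnWin (p q : ℕ) : Subset m → Subset m → Set where
      e-end  : ∀ {A F} → Empty F → AvoiderGoal A → EnforcerTurnWin p q A F
      e-move : ∀ {A F} → Nonempty F →
               (∀ M → LegalMove q F M → AvoiderTurnWin p q A (F ─ M)) →
               EnforcerTurnWin p q A F

  AvoiderCanIsolateVertex : ℕ → ℕ → Set
  AvoiderCanIsolateVertex p q = AvoiderTurnWin p q ⊥ ⊤

-- Encoding of the real-number condition  q ≥ d / ln (n / (2d+2))  (with
-- n > 2d+2, so the logarithm is positive):  it is equivalent to
-- e^d ≤ (n/(2d+2))^q, and since (1+1/k)^k increases to e, to
--   ∀ k ≥ 1,  ((k+1)/k)^(k d) ≤ (n/(2d+2))^q ,
-- cleared of denominators:
LnCondition : ℕ → ℕ → ℕ → Set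
LnCondition n d q = ∀ k → 1 ≤ k →
  (suc k) ^ (k * d) * (2 * d + 2) ^ q ≤ k ^ (k * d) * n ^ q

{-# OPTIONS --safe #-}

-- Avoider fixes an independent set I with n ≤ (2d+1)|I| (greedy) and only ever touches one
-- vertex of I per move.  Call v ∈ I live while none of Avoider's edges meets it, and give it
-- weight q^f (q+1)^(d−f), where f is the number of free edges at v; the potential is the total
-- weight of live vertices.  Initially it is ≥ |I| q^d ≥ (q+1)^d, which is where the hypothesis
-- on q enters.  Avoider picks a live v of maximal free degree g and claims every free edge not
-- meeting another live vertex: by independence only v dies, so the potential drops by at most
-- weight g, and afterwards every free edge meets a live vertex.  Enforcer's ≥ q edges then
-- lower the free degrees of live vertices by ≥ q in total; since removing an edge at a vertex
-- multiplies its weight by (q+1)/q, Bernoulli's inequality shows this regains at least weight g.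
-- So the potential stays ≥ (q+1)^d > 0 at Avoider's turns, and some live vertex survives.

module Submission where

open import Defs
open import Data.Nat using (ℕ; zero; suc; _+_; _*_; _^_; _∸_; _≤_; _<_; _⊓_; z≤n; s≤s; NonZero; >-nonZero; ≢-nonZero)
open import Data.Nat.Properties renaming (_≟_ to _≟ℕ_)
open import Data.Bool using (true; false; if_then_else_)
open import Data.Fin using (Fin; zero; suc; _≟_)
open import Data.Fin.Subset
  using (Subset; _∈_; _∉_; _⊆_; _⊂_; _─_; _∪_; ⁅_⁆; ∣_∣; Nonempty; Empty; ⊥; ⊤; inside; outside)
open import Data.Fin.Subset.Properties
  using (_∈?_; nonempty?; Empty-unique; ∉⊥; ⊥⊆; ∣⊥∣≡0; ∣⊤∣≡n; x∈⁅y⁆⇒x≡y; x∈p∩q⁺; x∈p∪q⁻;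
         x∈p∧x∉q⇒x∈p─q; p─q⊆p; p⊆p∪q; p⊂q⇒∣p∣<∣q∣; p∩q≢∅⇒∣p─q∣<∣p∣; ∣p─q∣≤∣p∣; p∩q≢∅⇒p─q⊂p; ∪-identityʳ)
open import Data.Fin.Subset.Induction using (Acc; acc; ⊂-wellFounded)
open import Data.Fin.Properties using (any?; all?)
open import Data.List using (length; filter)
import Data.List as List
open import Data.Vec using ([]; _∷_; here; there)
import Data.Vec as Vec
open import Data.Vec.Properties using (lookup∘tabulate; lookup⇒[]=; []=⇒lookup)
open import Data.Product using (∃; _×_; _,_; proj₁; proj₂; map₁)
open import Data.Sum using (_⊎_; inj₁; inj₂; [_,_]′)
open import Function using (_∘_; id)
open import Relation.Nullary using (¬_; ¬?; Dec; yes; no; does; contradiction)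
open import Relation.Nullary.Decidable using (dec-true; _×-dec_; _⊎-dec_; _→-dec_)
open import Relation.Binary.PropositionalEquality
  using (_≡_; _≢_; refl; sym; trans; cong; cong₂; subst; subst₂; module ≡-Reasoning)
open import Data.Nat.Solver using (module +-*-Solver)
open +-*-Solver using (solve; _:+_; _:*_; _:=_; con)

open import Algebra.Properties.Semiring.Sum +-*-semiring
  using (sum; sum-syntax; ∑-distrib-+; ∑-comm; sum-cong-≗; *-distribˡ-sum; *-distribʳ-sum; sum-replicate-zero)

𝟙 : {P : Set} → Dec P → ℕ
𝟙 P? = if does P? then 1 else 0

𝟙≡1 : ∀ {P : Set} (P? : Dec P) → P → 𝟙 P? ≡ 1
𝟙≡1 P? p = cong (if_then 1 else 0) (dec-true P? p)

𝟙≤ : ∀ {P : Set} (P? : Dec P) {x} → (P → 1 ≤ x) → 𝟙 P? ≤ x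
𝟙≤ (yes p) 1≤x = 1≤x p
𝟙≤ (no _)  _   = z≤n

𝟙-mono : ∀ {P Q : Set} (P? : Dec P) (Q? : Dec Q) → (P → Q) → 𝟙 P? ≤ 𝟙 Q?
𝟙-mono (no _)  _        _   = z≤n
𝟙-mono (yes _) (yes _)  _   = ≤-refl
𝟙-mono (yes p) (no ¬q) P⇒Q = contradiction (P⇒Q p) ¬q

𝟙≤1 : ∀ {P : Set} (P? : Dec P) → 𝟙 P? ≤ 1
𝟙≤1 (yes _) = ≤-refl
𝟙≤1 (no  _) = z≤n

𝟙-⊎ : ∀ {P Q R : Set} (R? : Dec R) (P? : Dec P) (Q? : Dec Q) → (R → P ⊎ Q) → 𝟙 R? ≤ 𝟙 P? + 𝟙 Q?
𝟙-⊎ (no _)  _       _       _   = z≤n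
𝟙-⊎ (yes _) (yes _) _       _   = s≤s z≤n
𝟙-⊎ (yes _) (no _)  (yes _) _   = s≤s z≤n
𝟙-⊎ (yes r) (no ¬p) (no ¬q) R⇒P⊎Q = contradiction (R⇒P⊎Q r) [ ¬p , ¬q ]′

𝟙-disjoint : ∀ {P Q R : Set} (P? : Dec P) (Q? : Dec Q) (R? : Dec R) →
  (P → ¬ Q) → (P → R) → (Q → R) → 𝟙 P? + 𝟙 Q? ≤ 𝟙 R?
𝟙-disjoint (no _)  (no _)  _       _      _   _   = z≤n
𝟙-disjoint (no _)  (yes q) R?      _      _   Q⇒R = 𝟙-mono (yes q) R? Q⇒R
𝟙-disjoint (yes p) (no _)  R?      _      P⇒R _   = 𝟙-mono (yes p) R? P⇒R
𝟙-disjoint (yes p) (yes q) _       P⇒¬Q   _   _   = contradiction q (P⇒¬Q p)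

𝟙>0⇒ : ∀ {P : Set} (P? : Dec P) → 0 < 𝟙 P? → P
𝟙>0⇒ (yes p) _ = p

𝟙*>0⇒ : ∀ {P : Set} (P? : Dec P) {x} → 0 < 𝟙 P? * x → P
𝟙*>0⇒ (yes p) _ = p

𝟙*-mono : ∀ {P : Set} (P? : Dec P) {x y} → (P → x ≤ y) → 𝟙 P? * x ≤ 𝟙 P? * y
𝟙*-mono (yes p) x≤y = *-monoʳ-≤ 1 (x≤y p)
𝟙*-mono (no _)  _   = z≤n

sum-mono-≤ : ∀ {k} {f g : Fin k → ℕ} → (∀ i → f i ≤ g i) → sum f ≤ sum g
sum-mono-≤ {zero}  _   = z≤n
sum-mono-≤ {suc k} f≤g = +-mono-≤ (f≤g zero) (sum-mono-≤ (f≤g ∘ suc))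

≤-sum : ∀ {k} (f : Fin k → ℕ) i → f i ≤ sum f
≤-sum f zero    = m≤m+n _ _
≤-sum f (suc i) = ≤-trans (≤-sum (f ∘ suc) i) (m≤n+m _ _)

sum>0⇒∃>0 : ∀ {k} (f : Fin k → ℕ) → 0 < sum f → ∃ λ i → 0 < f i
sum>0⇒∃>0 {suc k} f pos with f zero in f₀≡
... | suc _ = zero , subst (0 <_) (sym f₀≡) (s≤s z≤n)
... | zero  with sum>0⇒∃>0 (f ∘ suc) pos
...   | i , fi>0 = suc i , fi>0

∑𝟙[≟] : ∀ {k} (a : Fin k) → ∑[ u < k ] 𝟙 (u ≟ a) ≡ 1
∑𝟙[≟] {suc k} zero    = cong suc (sum-replicate-zero k)
∑𝟙[≟] {suc k} (suc a) = ∑𝟙[≟] a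

length-filter-tabulate : ∀ {A : Set} {P : A → Set} (P? : ∀ x → Dec (P x)) {k} (f : Fin k → A) →
  length (filter P? (List.tabulate f)) ≡ ∑[ i < k ] 𝟙 (P? (f i))
length-filter-tabulate P? {zero}  f = refl
length-filter-tabulate P? {suc k} f with does (P? (f zero))
... | true  = cong suc (length-filter-tabulate P? (f ∘ suc))
... | false = length-filter-tabulate P? (f ∘ suc)

∣p∣≡∑𝟙[∈] : ∀ {k} (p : Subset k) → ∣ p ∣ ≡ ∑[ i < k ] 𝟙 (i ∈? p)
∣p∣≡∑𝟙[∈] []            = refl
∣p∣≡∑𝟙[∈] (inside  ∷ p) = cong suc (∣p∣≡∑𝟙[∈] p)
∣p∣≡∑𝟙[∈] (outside ∷ p) = ∣p∣≡∑𝟙[∈] p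

x∈p─q⇒x∉q : ∀ {k} {x : Fin k} (p q : Subset k) → x ∈ p ─ q → x ∉ q
x∈p─q⇒x∉q (inside ∷ p) (outside ∷ q) here        ()
x∈p─q⇒x∉q (_ ∷ p)      (_ ∷ q)       (there x∈) (there x∈q) = x∈p─q⇒x∉q p q x∈ x∈q

∣p∣≤∣p─q∣+∣q∣ : ∀ {k} (p q : Subset k) → ∣ p ∣ ≤ ∣ p ─ q ∣ + ∣ q ∣
∣p∣≤∣p─q∣+∣q∣ {k} p q = begin
  ∣ p ∣                                          ≡⟨ ∣p∣≡∑𝟙[∈] p ⟩
  ∑[ i < k ] 𝟙 (i ∈? p)                          ≤⟨ sum-mono-≤ split ⟩
  ∑[ i < k ] (𝟙 (i ∈? p ─ q) + 𝟙 (i ∈? q))       ≡⟨ ∑-distrib-+ (λ i → 𝟙 (i ∈? p ─ q)) (λ i → 𝟙 (i ∈? q)) ⟩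
  ∑[ i < k ] 𝟙 (i ∈? p ─ q) + ∑[ i < k ] 𝟙 (i ∈? q) ≡⟨ cong₂ _+_ (∣p∣≡∑𝟙[∈] (p ─ q)) (∣p∣≡∑𝟙[∈] q) ⟨
  ∣ p ─ q ∣ + ∣ q ∣                              ∎
  where
  open ≤-Reasoning
  split : ∀ i → 𝟙 (i ∈? p) ≤ 𝟙 (i ∈? p ─ q) + 𝟙 (i ∈? q)
  split i = 𝟙-⊎ (i ∈? p) (i ∈? p ─ q) (i ∈? q) in-difference-or-q
    where
    in-difference-or-q : i ∈ p → i ∈ p ─ q ⊎ i ∈ q
    in-difference-or-q i∈p with i ∈? q
    ... | yes i∈q = inj₂ i∈q
    ... | no  i∉q = inj₁ (x∈p∧x∉q⇒x∈p─q i∈p i∉q)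

x∉p⇒∣p∪⁅x⁆∣≡1+∣p∣ : ∀ {k} {x : Fin k} (p : Subset k) → x ∉ p → ∣ p ∪ ⁅ x ⁆ ∣ ≡ suc ∣ p ∣
x∉p⇒∣p∪⁅x⁆∣≡1+∣p∣ {x = zero}  (inside  ∷ p) x∉p = contradiction here x∉p
x∉p⇒∣p∪⁅x⁆∣≡1+∣p∣ {x = zero}  (outside ∷ p) _   = cong (suc ∘ ∣_∣) (∪-identityʳ p)
x∉p⇒∣p∪⁅x⁆∣≡1+∣p∣ {x = suc x} (inside  ∷ p) x∉p = cong suc (x∉p⇒∣p∪⁅x⁆∣≡1+∣p∣ p (x∉p ∘ there))
x∉p⇒∣p∪⁅x⁆∣≡1+∣p∣ {x = suc x} (outside ∷ p) x∉p = x∉p⇒∣p∪⁅x⁆∣≡1+∣p∣ p (x∉p ∘ there)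

x∈p⇒0<∣p∣ : ∀ {k} {x : Fin k} (p : Subset k) → x ∈ p → 0 < ∣ p ∣
x∈p⇒0<∣p∣ {x = x} p x∈p = begin
  1                       ≡⟨ 𝟙≡1 (x ∈? p) x∈p ⟨
  𝟙 (x ∈? p)              ≤⟨ ≤-sum (λ i → 𝟙 (i ∈? p)) x ⟩
  ∑[ i < _ ] 𝟙 (i ∈? p)   ≡⟨ ∣p∣≡∑𝟙[∈] p ⟨
  ∣ p ∣                   ∎
  where open ≤-Reasoning

a⊓∣p∣≤∣q∣⇒a≤∣q∣ : ∀ {k} {p q : Subset k} a → q ⊆ p → Nonempty (p ─ q) → a ⊓ ∣ p ∣ ≤ ∣ q ∣ → a ≤ ∣ q ∣
a⊓∣p∣≤∣q∣⇒a≤∣q∣ {p = p} {q} a q⊆p (x , x∈p─q) a⊓∣p∣≤∣q∣ with ⊓-sel a ∣ p ∣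
... | inj₁ a⊓∣p∣≡a = subst (_≤ ∣ q ∣) a⊓∣p∣≡a a⊓∣p∣≤∣q∣
... | inj₂ a⊓∣p∣≡∣p∣ = contradiction (subst (_≤ ∣ q ∣) a⊓∣p∣≡∣p∣ a⊓∣p∣≤∣q∣) (<⇒≱ ∣q∣<∣p∣)
  where
  ∣q∣<∣p∣ : ∣ q ∣ < ∣ p ∣
  ∣q∣<∣p∣ = p⊂q⇒∣p∣<∣q∣ (q⊆p , x , p─q⊆p p q x∈p─q , x∈p─q⇒x∉q p q x∈p─q)

subset : ∀ {k} {P : Fin k → Set} → (∀ i → Dec (P i)) → Subset k
subset P? = Vec.tabulate (λ i → does (P? i))

∈-subset⁺ : ∀ {k} {P : Fin k → Set} (P? : ∀ i → Dec (P i)) {i} → P i → i ∈ subset P?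
∈-subset⁺ P? {i} Pi = lookup⇒[]= i (subset P?) (trans (lookup∘tabulate _ i) (dec-true (P? i) Pi))

∈-subset⁻ : ∀ {k} {P : Fin k → Set} (P? : ∀ i → Dec (P i)) {i} → i ∈ subset P? → P i
∈-subset⁻ P? {i} i∈ with P? i | trans (sym (lookup∘tabulate (does ∘ P?) i)) ([]=⇒lookup i∈)
... | yes Pi | _ = Pi
... | no _   | ()

argmax : ∀ {k} {P : Fin k → Set} → (∀ i → Dec (P i)) → (f : Fin k → ℕ) → ∃ P →
  ∃ λ v → P v × (∀ u → P u → f u ≤ f v)
argmax {suc k} P? f ∃P with any? (P? ∘ suc)
argmax {suc k} P? f (zero , P0) | no ¬Psuc =
  zero , P0 , λ { zero _ → ≤-refl ; (suc u) Pu → contradiction (u , Pu) ¬Psuc }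
argmax {suc k} P? f (suc u , Pu) | no ¬Psuc = contradiction (u , Pu) ¬Psuc
... | yes ∃Psuc with argmax (P? ∘ suc) (f ∘ suc) ∃Psuc | P? zero
...   | v , Pv , max | no ¬P0 =
  suc v , Pv , λ { zero P0 → contradiction P0 ¬P0 ; (suc u) → max u }
...   | v , Pv , max | yes P0 with f zero ≤? f (suc v)
...     | yes f0≤ = suc v , Pv , λ { zero _ → f0≤ ; (suc u) → max u }
...     | no  f0≰ = zero , P0 , λ { zero _ → ≤-refl ; (suc u) Pu → ≤-trans (max u Pu) (<⇒≤ (≰⇒> f0≰)) }

-- Weights

-- Bernoulli's inequality (1 + 1/q)^k ≥ 1 + k/q, cleared of denominators.
bernoulli : ∀ q k → (q + k) * q ^ k ≤ q * suc q ^ k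
bernoulli q zero = ≤-reflexive (trans (*-identityʳ (q + 0)) (trans (+-identityʳ q) (sym (*-identityʳ q))))
bernoulli q (suc k) = begin
  (q + suc k) * (q * q ^ k)                   ≡⟨ expand ⟩
  q * q ^ k + q * ((q + k) * q ^ k)           ≤⟨ +-monoˡ-≤ _ (*-monoˡ-≤ (q ^ k) (m≤m+n q k)) ⟩
  suc q * ((q + k) * q ^ k)                   ≤⟨ *-monoʳ-≤ (suc q) (bernoulli q k) ⟩
  suc q * (q * suc q ^ k)                     ≡⟨ *-comm-middle ⟩
  q * suc q ^ suc k                           ∎
  where
  open ≤-Reasoning
  expand = solve 3 (λ a b c → (a :+ (con 1 :+ b)) :* (a :* c) := a :* c :+ a :* ((a :+ b) :* c))
                   refl q k (q ^ k)
  *-comm-middle = solve 2 (λ a c → (con 1 :+ a) :* (a :* c) := a :* ((con 1 :+ a) :* c))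
                          refl q (suc q ^ k)

^-distribʳ-* : ∀ a b k → (a * b) ^ k ≡ a ^ k * b ^ k
^-distribʳ-* a b zero    = refl
^-distribʳ-* a b (suc k) = trans (cong (a * b *_) (^-distribʳ-* a b k))
  (solve 4 (λ x y z w → (x :* y) :* (z :* w) := (x :* z) :* (y :* w)) refl a b (a ^ k) (b ^ k))

^-cancelʳ-≤ : ∀ {a b} k .{{_ : NonZero k}} → a ^ k ≤ b ^ k → a ≤ b
^-cancelʳ-≤ {a} {b} k aᵏ≤bᵏ with a ≤? b
... | yes a≤b = a≤b
... | no  a≰b = contradiction aᵏ≤bᵏ (<⇒≱ (^-monoˡ-< k (≰⇒> a≰b)))

module Weight (d q : ℕ) where

  weight : ℕ → ℕ
  weight f = q ^ f * suc q ^ (d ∸ f)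

  private
    rest : ℕ → ℕ → ℕ
    rest j k = suc q ^ (d ∸ (j + k))

  weight-+ : ∀ j k → weight (j + k) ≡ q ^ j * q ^ k * rest j k
  weight-+ j k = cong (_* rest j k) (^-distribˡ-+-* q j k)

  weight-≡ : ∀ j k → j + k ≤ d → weight j ≡ q ^ j * suc q ^ k * rest j k
  weight-≡ j k j+k≤d = begin
    q ^ j * suc q ^ (d ∸ j)               ≡⟨ cong (λ e → q ^ j * suc q ^ e) d∸j≡k+rest ⟩
    q ^ j * suc q ^ (k + (d ∸ (j + k)))   ≡⟨ cong (q ^ j *_) (^-distribˡ-+-* (suc q) k _) ⟩
    q ^ j * (suc q ^ k * rest j k)        ≡⟨ *-assoc (q ^ j) _ _ ⟨
    q ^ j * suc q ^ k * rest j k          ∎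
    where
    open ≡-Reasoning
    d∸j≡k+rest : d ∸ j ≡ k + (d ∸ (j + k))
    d∸j≡k+rest = trans (sym (m+[n∸m]≡n (m+n≤o⇒m≤o∸n k (subst (_≤ d) (+-comm j k) j+k≤d))))
                       (cong (k +_) (∸-+-assoc d j k))

  weight-+-≤ : ∀ j k → j + k ≤ d → weight (j + k) ≤ weight j
  weight-+-≤ j k j+k≤d = begin
    weight (j + k)                 ≡⟨ weight-+ j k ⟩
    q ^ j * q ^ k * rest j k       ≤⟨ *-monoˡ-≤ (rest j k) (*-monoʳ-≤ (q ^ j) (^-monoˡ-≤ k (n≤1+n q))) ⟩
    q ^ j * suc q ^ k * rest j k   ≡⟨ weight-≡ j k j+k≤d ⟨
    weight j                       ∎
    where open ≤-Reasoning

  weight-antitone : ∀ {f g} → f ≤ g → g ≤ d → weight g ≤ weight f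
  weight-antitone {f} {g} f≤g g≤d = subst (λ h → weight h ≤ weight f) f+[g∸f]≡g
    (weight-+-≤ f (g ∸ f) (subst (_≤ d) (sym f+[g∸f]≡g) g≤d))
    where f+[g∸f]≡g = m+[n∸m]≡n f≤g

  q^d≤weight : ∀ {f} → f ≤ d → q ^ d ≤ weight f
  q^d≤weight {f} f≤d = subst (_≤ weight f) weight-d≡q^d (weight-antitone f≤d ≤-refl)
    where
    weight-d≡q^d : weight d ≡ q ^ d
    weight-d≡q^d = trans (cong (λ e → q ^ d * suc q ^ e) (n∸n≡0 d)) (*-identityʳ _)

  weight<suc[q]^d : ∀ {g} → 1 ≤ g → g ≤ d → weight g < suc q ^ d
  weight<suc[q]^d {g} 1≤g g≤d = begin-strict
    weight (0 + g)               ≡⟨ weight-+ 0 g ⟩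
    1 * q ^ g * rest 0 g         <⟨ *-monoˡ-< (rest 0 g) {{m^n≢0 (suc q) (d ∸ g)}}
                                      (*-monoʳ-< 1 (^-monoˡ-< g {{>-nonZero 1≤g}} (n<1+n q))) ⟩
    1 * suc q ^ g * rest 0 g     ≡⟨ weight-≡ 0 g g≤d ⟨
    weight 0                     ≡⟨ *-identityˡ _ ⟩
    suc q ^ d                    ∎
    where open ≤-Reasoning

  weight≡0 : ∀ {g} → q ≡ 0 → 1 ≤ g → weight g ≡ 0
  weight≡0 {suc g} q≡0 _ = trans (*-assoc q (q ^ g) _) (cong (_* (q ^ g * suc q ^ (d ∸ suc g))) q≡0)

  weight-gain : ∀ {g} j k → j + k ≤ g → g ≤ d → q * weight (j + k) + k * weight g ≤ q * weight j
  weight-gain {g} j k j+k≤g g≤d = begin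
    q * weight (j + k) + k * weight g          ≤⟨ +-monoʳ-≤ _ (*-monoʳ-≤ k (weight-antitone j+k≤g g≤d)) ⟩
    q * weight (j + k) + k * weight (j + k)    ≡⟨ *-distribʳ-+ (weight (j + k)) q k ⟨
    (q + k) * weight (j + k)                   ≡⟨ cong ((q + k) *_) (weight-+ j k) ⟩
    (q + k) * (q ^ j * q ^ k * R)              ≡⟨ regroup ⟩
    q ^ j * ((q + k) * q ^ k) * R              ≤⟨ *-monoˡ-≤ R (*-monoʳ-≤ (q ^ j) (bernoulli q k)) ⟩
    q ^ j * (q * suc q ^ k) * R                ≡⟨ regroup′ ⟩
    q * (q ^ j * suc q ^ k * R)                ≡⟨ cong (q *_) (weight-≡ j k (≤-trans j+k≤g g≤d)) ⟨
    q * weight j                               ∎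
    where
    open ≤-Reasoning
    R = rest j k
    regroup = solve 5 (λ a b c e f → (a :+ b) :* (c :* e :* f) := c :* ((a :+ b) :* e) :* f)
                      refl q k (q ^ j) (q ^ k) R
    regroup′ = solve 4 (λ a c e f → c :* (a :* e) :* f := a :* (c :* e :* f))
                       refl q (q ^ j) (suc q ^ k) R

-- The instance k = q of the condition is the q-th power of this inequality.
lnCondition⇒root : ∀ {n d q} → 1 ≤ q → LnCondition n d q → suc q ^ d * (2 * d + 2) ≤ q ^ d * n
lnCondition⇒root {n} {d} {q} 1≤q ln =
  ^-cancelʳ-≤ q {{>-nonZero 1≤q}} (subst₂ _≤_ (as-power (suc q) _) (as-power q n) (ln q 1≤q))
  where
  as-power : ∀ a b → a ^ (q * d) * b ^ q ≡ (a ^ d * b) ^ q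
  as-power a b = trans (cong (_* b ^ q) (trans (cong (a ^_) (*-comm q d)) (sym (^-*-assoc a d q))))
                       (sym (^-distribʳ-* (a ^ d) b q))

¬lnCondition[q≡0] : ∀ {n d} → ¬ LnCondition n (suc d) 0
¬lnCondition[q≡0] {n} {d} ln = <⇒≱ 1<lhs (≤-trans (ln 1 ≤-refl) (≤-reflexive rhs≡1))
  where
  1<lhs : 1 < 2 ^ (1 * suc d) * (2 * suc d + 2) ^ 0
  1<lhs = ≤-trans (*-monoʳ-≤ 2 (m^n>0 2 (d + 0))) (≤-reflexive (sym (*-identityʳ _)))
  rhs≡1 : 1 ^ (1 * suc d) * n ^ 0 ≡ 1
  rhs≡1 = trans (*-identityʳ _) (^-zeroˡ (1 * suc d))

lnCondition⇒suc[q]^d≤c*q^d : ∀ {n d q c} → 2 * d + 2 < n → LnCondition n d q →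
  n ≤ (2 * d + 1) * c → suc q ^ d ≤ c * q ^ d
lnCondition⇒suc[q]^d≤c*q^d {n} {zero} {zero} {c} 2<n _ n≤c =
  ≤-trans (≤-trans (s≤s z≤n) (<⇒≤ 2<n)) (≤-trans n≤c (≤-reflexive (trans (*-identityˡ c) (sym (*-identityʳ c)))))
lnCondition⇒suc[q]^d≤c*q^d {n} {suc d} {zero} _ ln _ = contradiction ln (¬lnCondition[q≡0] {n})
lnCondition⇒suc[q]^d≤c*q^d {n} {d} {q@(suc _)} {c} _ ln n≤[2d+1]c =
  *-cancelʳ-≤ (suc q ^ d) (c * q ^ d) (2 * d + 2) {{>-nonZero (≤-trans (s≤s z≤n) (m≤n+m 2 (2 * d)))}} (begin
    suc q ^ d * (2 * d + 2)     ≤⟨ lnCondition⇒root (s≤s z≤n) ln ⟩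
    q ^ d * n                   ≤⟨ *-monoʳ-≤ (q ^ d) (≤-trans n≤[2d+1]c (*-monoˡ-≤ c (m≤m+n (2 * d + 1) 1))) ⟩
    q ^ d * ((2 * d + 1 + 1) * c) ≡⟨ regroup ⟩
    c * q ^ d * (2 * d + 2)     ∎)
  where
  open ≤-Reasoning
  regroup = solve 3 (λ a b e → a :* ((con 2 :* b :+ con 1 :+ con 1) :* e) := e :* a :* (con 2 :* b :+ con 2))
                    refl (q ^ d) d c

-- Independent sets in graphs of bounded degree

module _ {n : ℕ} (G : Graph n) where
  open Graph G

  Independent : Subset n → Set
  Independent I = ∀ e → proj₁ (ends e) ∈ I → proj₂ (ends e) ∉ I

  degree≡∑ : ∀ v → degree G v ≡ ∑[ e < m ] 𝟙 (incident? G v e)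
  degree≡∑ v = length-filter-tabulate (incident? G v) id

  ∑𝟙[incident]≤2 : ∀ e → ∑[ u < n ] 𝟙 (incident? G u e) ≤ 2
  ∑𝟙[incident]≤2 e = begin
    ∑[ u < n ] 𝟙 (incident? G u e)                  ≤⟨ sum-mono-≤ at-endpoint ⟩
    ∑[ u < n ] (𝟙 (u ≟ a) + 𝟙 (u ≟ b))              ≡⟨ ∑-distrib-+ (λ u → 𝟙 (u ≟ a)) (λ u → 𝟙 (u ≟ b)) ⟩
    ∑[ u < n ] 𝟙 (u ≟ a) + ∑[ u < n ] 𝟙 (u ≟ b)     ≡⟨ cong₂ _+_ (∑𝟙[≟] a) (∑𝟙[≟] b) ⟩
    2                                               ∎
    where
    open ≤-Reasoning
    a = proj₁ (ends e)
    b = proj₂ (ends e)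
    at-endpoint : ∀ u → 𝟙 (incident? G u e) ≤ 𝟙 (u ≟ a) + 𝟙 (u ≟ b)
    at-endpoint u = 𝟙-⊎ (incident? G u e) (u ≟ a) (u ≟ b) id

  Near : Fin n → Fin n → Set
  Near v u = u ≡ v ⊎ ∃ λ e → Incident G v e × Incident G u e

  near? : ∀ v u → Dec (Near v u)
  near? v u = (u ≟ v) ⊎-dec any? (λ e → incident? G v e ×-dec incident? G u e)

  closedNeighbourhood : Fin n → Subset n
  closedNeighbourhood v = subset (near? v)

  ∣closedNeighbourhood∣≤ : ∀ v → ∣ closedNeighbourhood v ∣ ≤ 2 * degree G v + 1
  ∣closedNeighbourhood∣≤ v = begin
    ∣ closedNeighbourhood v ∣
      ≡⟨ ∣p∣≡∑𝟙[∈] (closedNeighbourhood v) ⟩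
    ∑[ u < n ] 𝟙 (u ∈? closedNeighbourhood v)
      ≤⟨ sum-mono-≤ near-bound ⟩
    ∑[ u < n ] (𝟙 (u ≟ v) + ∑[ e < m ] shared u e)
      ≡⟨ ∑-distrib-+ (λ u → 𝟙 (u ≟ v)) (λ u → ∑[ e < m ] shared u e) ⟩
    ∑[ u < n ] 𝟙 (u ≟ v) + ∑[ u < n ] ∑[ e < m ] shared u e
      ≡⟨ cong₂ _+_ (∑𝟙[≟] v) (∑-comm shared) ⟩
    1 + ∑[ e < m ] ∑[ u < n ] shared u e
      ≡⟨ cong (1 +_) (sum-cong-≗ λ e → *-distribˡ-sum (𝟙 (incident? G v e)) (λ u → 𝟙 (incident? G u e))) ⟨
    1 + ∑[ e < m ] (𝟙 (incident? G v e) * ∑[ u < n ] 𝟙 (incident? G u e))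
      ≤⟨ +-monoʳ-≤ 1 (sum-mono-≤ λ e → *-monoʳ-≤ (𝟙 (incident? G v e)) (∑𝟙[incident]≤2 e)) ⟩
    1 + ∑[ e < m ] (𝟙 (incident? G v e) * 2)
      ≡⟨ cong (1 +_) (*-distribʳ-sum 2 (λ e → 𝟙 (incident? G v e))) ⟨
    1 + ∑[ e < m ] 𝟙 (incident? G v e) * 2
      ≡⟨ cong (λ x → 1 + x * 2) (degree≡∑ v) ⟨
    1 + degree G v * 2
      ≡⟨ trans (+-comm 1 (degree G v * 2)) (cong (_+ 1) (*-comm (degree G v) 2)) ⟩
    2 * degree G v + 1
      ∎
    where
    open ≤-Reasoning
    shared : Fin n → Fin m → ℕ
    shared u e = 𝟙 (incident? G v e) * 𝟙 (incident? G u e)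
    near-bound : ∀ u → 𝟙 (u ∈? closedNeighbourhood v) ≤ 𝟙 (u ≟ v) + ∑[ e < m ] shared u e
    near-bound u with u ∈? closedNeighbourhood v
    ... | no  _   = z≤n
    ... | yes u∈N with ∈-subset⁻ (near? v) u∈N
    ...   | inj₁ u≡v = ≤-trans (≤-reflexive (sym (𝟙≡1 (u ≟ v) u≡v))) (m≤m+n _ _)
    ...   | inj₂ (e , ve , ue) =
      ≤-trans (≤-reflexive (sym (cong₂ _*_ (𝟙≡1 (incident? G v e) ve) (𝟙≡1 (incident? G u e) ue))))
              (≤-trans (≤-sum (shared u) e) (m≤n+m _ _))

  module _ {d : ℕ} (deg≤d : ∀ v → degree G v ≤ d) where

    greedy-independent : ∀ C → Acc _⊂_ C →
      ∃ λ I → I ⊆ C × Independent I × ∣ C ∣ ≤ (2 * d + 1) * ∣ I ∣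
    greedy-independent C (acc rec) with nonempty? C
    ... | no C-empty = ⊥ , ⊥⊆ , (λ _ p∈⊥ _ → ∉⊥ p∈⊥) ,
                       ≤-trans (≤-reflexive (trans (cong ∣_∣ (Empty-unique C-empty)) (∣⊥∣≡0 n))) z≤n
    ... | yes (v , v∈C)
        with greedy-independent (C ─ closedNeighbourhood v)
               (rec (p∩q≢∅⇒p─q⊂p C _ (v , x∈p∩q⁺ (v∈C , ∈-subset⁺ (near? v) (inj₁ refl)))))
    ...   | I′ , I′⊆C′ , I′-independent , C′-size = I , I⊆C , I-independent , size
      where
      N = closedNeighbourhood v
      I = I′ ∪ ⁅ v ⁆
      far : ∀ {u} → u ∈ I′ → ¬ Near v u
      far u∈I′ = x∈p─q⇒x∉q C N (I′⊆C′ u∈I′) ∘ ∈-subset⁺ (near? v)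
      I⊆C : I ⊆ C
      I⊆C x∈I with x∈p∪q⁻ I′ ⁅ v ⁆ x∈I
      ... | inj₁ x∈I′ = p─q⊆p C N (I′⊆C′ x∈I′)
      ... | inj₂ x∈v  = subst (_∈ C) (sym (x∈⁅y⁆⇒x≡y v x∈v)) v∈C
      I-independent : Independent I
      I-independent e a∈I b∈I with x∈p∪q⁻ I′ ⁅ v ⁆ a∈I | x∈p∪q⁻ I′ ⁅ v ⁆ b∈I
      ... | inj₁ a∈I′ | inj₁ b∈I′ = I′-independent e a∈I′ b∈I′
      ... | inj₁ a∈I′ | inj₂ b∈v  = far a∈I′ (inj₂ (e , inj₂ (sym (x∈⁅y⁆⇒x≡y v b∈v)) , inj₁ refl))
      ... | inj₂ a∈v  | inj₁ b∈I′ = far b∈I′ (inj₂ (e , inj₁ (sym (x∈⁅y⁆⇒x≡y v a∈v)) , inj₂ refl))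
      ... | inj₂ a∈v  | inj₂ b∈v  = loopless e (trans (x∈⁅y⁆⇒x≡y v a∈v) (sym (x∈⁅y⁆⇒x≡y v b∈v)))
      size : ∣ C ∣ ≤ (2 * d + 1) * ∣ I ∣
      size = begin
        ∣ C ∣                               ≤⟨ ∣p∣≤∣p─q∣+∣q∣ C N ⟩
        ∣ C ─ N ∣ + ∣ N ∣                   ≤⟨ +-mono-≤ C′-size (≤-trans (∣closedNeighbourhood∣≤ v)
                                                                (+-monoˡ-≤ 1 (*-monoʳ-≤ 2 (deg≤d v)))) ⟩
        (2 * d + 1) * ∣ I′ ∣ + (2 * d + 1)  ≡⟨ trans (+-comm _ (2 * d + 1)) (sym (*-suc (2 * d + 1) ∣ I′ ∣)) ⟩
        (2 * d + 1) * suc ∣ I′ ∣            ≡⟨ cong ((2 * d + 1) *_) ∣I∣≡1+∣I′∣ ⟨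
        (2 * d + 1) * ∣ I ∣                 ∎
        where
        open ≤-Reasoning
        ∣I∣≡1+∣I′∣ = x∉p⇒∣p∪⁅x⁆∣≡1+∣p∣ I′ (λ v∈I′ → far v∈I′ (inj₁ refl))

    independent-set : ∃ λ I → Independent I × n ≤ (2 * d + 1) * ∣ I ∣
    independent-set with greedy-independent ⊤ (⊂-wellFounded ⊤)
    ... | I , _ , independent , size = I , independent , subst (_≤ (2 * d + 1) * ∣ I ∣) (∣⊤∣≡n n) size

-- Avoider's strategy

module AvoiderStrategy {n : ℕ} (G : Graph n) {d : ℕ} (deg≤d : ∀ v → degree G v ≤ d) (q : ℕ)
                       {I : Subset n} (I-independent : Independent G I) where
  open Graph G
  open Weight d q

  Untouched : Subset m → Fin n → Set
  Untouched A v = ∀ e → e ∈ A → ¬ Incident G v e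

  untouched? : ∀ A v → Dec (Untouched A v)
  untouched? A v = all? (λ e → e ∈? A →-dec ¬? (incident? G v e))

  Live : Subset m → Fin n → Set
  Live A v = v ∈ I × Untouched A v

  live? : ∀ A v → Dec (Live A v)
  live? A v = (v ∈? I) ×-dec untouched? A v

  live⇒goal : ∀ {A} → ∃ (Live A) → AvoiderGoal G A
  live⇒goal (v , _ , untouched) = v , untouched

  live-∪⁻ : ∀ {A} M {v} → Live (A ∪ M) v → Live A v
  live-∪⁻ M (v∈I , untouched) = v∈I , λ e e∈A → untouched e (p⊆p∪q M e∈A)

  freeDegree : Subset m → Fin n → ℕ
  freeDegree F v = ∑[ e < m ] 𝟙 (e ∈? F ×-dec incident? G v e)

  freeDegree≤d : ∀ F v → freeDegree F v ≤ d
  freeDegree≤d F v = begin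
    freeDegree F v                   ≤⟨ sum-mono-≤ (λ e → 𝟙-mono (e ∈? F ×-dec incident? G v e)
                                                                  (incident? G v e) proj₂) ⟩
    ∑[ e < m ] 𝟙 (incident? G v e)   ≡⟨ degree≡∑ G v ⟨
    degree G v                       ≤⟨ deg≤d v ⟩
    d                                ∎
    where open ≤-Reasoning

  freeDegree-mono : ∀ {F′ F} → F′ ⊆ F → ∀ v → freeDegree F′ v ≤ freeDegree F v
  freeDegree-mono {F′} {F} F′⊆F v =
    sum-mono-≤ (λ e → 𝟙-mono (e ∈? F′ ×-dec incident? G v e) (e ∈? F ×-dec incident? G v e) (map₁ F′⊆F))

  freeDegree-─ : ∀ {F M} → M ⊆ F → ∀ v → freeDegree (F ─ M) v + freeDegree M v ≤ freeDegree F v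
  freeDegree-─ {F} {M} M⊆F v = begin
    freeDegree (F ─ M) v + freeDegree M v  ≡⟨ ∑-distrib-+ (free (F ─ M)) (free M) ⟨
    ∑[ e < m ] (free (F ─ M) e + free M e) ≤⟨ sum-mono-≤ split ⟩
    freeDegree F v                         ∎
    where
    open ≤-Reasoning
    free : Subset m → Fin m → ℕ
    free X e = 𝟙 (e ∈? X ×-dec incident? G v e)
    split : ∀ e → free (F ─ M) e + free M e ≤ free F e
    split e = 𝟙-disjoint (e ∈? F ─ M ×-dec incident? G v e) (e ∈? M ×-dec incident? G v e)
                         (e ∈? F ×-dec incident? G v e)
                         (λ (e∈F─M , _) (e∈M , _) → x∈p─q⇒x∉q F M e∈F─M e∈M)
                         (map₁ (p─q⊆p F M)) (map₁ M⊆F)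

  freeDegree>0 : ∀ {F v} → 0 < freeDegree F v → ∃ λ e → e ∈ F × Incident G v e
  freeDegree>0 {F} {v} pos with sum>0⇒∃>0 _ pos
  ... | e , term>0 = e , 𝟙>0⇒ (e ∈? F ×-dec incident? G v e) term>0

  freeDegree<1 : ∀ {F v e} → freeDegree F v < 1 → e ∈ F → ¬ Incident G v e
  freeDegree<1 {F} {v} {e} <1 e∈F v∼e = <⇒≱ <1 (begin
    1                                      ≡⟨ 𝟙≡1 (e ∈? F ×-dec incident? G v e) (e∈F , v∼e) ⟨
    𝟙 (e ∈? F ×-dec incident? G v e)       ≤⟨ ≤-sum (λ e → 𝟙 (e ∈? F ×-dec incident? G v e)) e ⟩
    freeDegree F v                         ∎)
    where open ≤-Reasoning

  potential : Subset m → Subset m → ℕ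
  potential A F = ∑[ v < n ] (𝟙 (live? A v) * weight (freeDegree F v))

  potential-antitone : ∀ A {F F′} → F′ ⊆ F → potential A F ≤ potential A F′
  potential-antitone A F′⊆F = sum-mono-≤ λ v →
    *-monoʳ-≤ (𝟙 (live? A v)) (weight-antitone (freeDegree-mono F′⊆F v) (freeDegree≤d _ v))

  potential>0⇒live : ∀ A F → 0 < potential A F → ∃ (Live A)
  potential>0⇒live A F pos with sum>0⇒∃>0 _ pos
  ... | v , term>0 = v , 𝟙*>0⇒ (live? A v) term>0

  Covered : Subset m → Subset m → Set
  Covered A F = ∀ {e} → e ∈ F → ∃ λ u → Live A u × Incident G u e

  covered⇒∣M∣≤ : ∀ {A F M} → M ⊆ F → Covered A F →
    ∣ M ∣ ≤ ∑[ u < n ] (𝟙 (live? A u) * freeDegree M u)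
  covered⇒∣M∣≤ {A} {F} {M} M⊆F covered = begin
    ∣ M ∣                                       ≡⟨ ∣p∣≡∑𝟙[∈] M ⟩
    ∑[ e < m ] 𝟙 (e ∈? M)                       ≤⟨ sum-mono-≤ at-live-endpoint ⟩
    ∑[ e < m ] ∑[ u < n ] live-endpoint e u     ≡⟨ ∑-comm live-endpoint ⟩
    ∑[ u < n ] ∑[ e < m ] live-endpoint e u     ≡⟨ sum-cong-≗ (λ u → *-distribˡ-sum (𝟙 (live? A u)) (free u)) ⟨
    ∑[ u < n ] (𝟙 (live? A u) * freeDegree M u) ∎
    where
    open ≤-Reasoning
    free : Fin n → Fin m → ℕ
    free u e = 𝟙 (e ∈? M ×-dec incident? G u e)
    live-endpoint : Fin m → Fin n → ℕ
    live-endpoint e u = 𝟙 (live? A u) * free u e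
    at-live-endpoint : ∀ e → 𝟙 (e ∈? M) ≤ ∑[ u < n ] live-endpoint e u
    at-live-endpoint e = 𝟙≤ (e ∈? M) λ e∈M →
      let u , u-live , u∼e = covered (M⊆F e∈M) in ≤-trans
        (≤-reflexive (sym (cong₂ _*_ (𝟙≡1 (live? A u) u-live) (𝟙≡1 (e ∈? M ×-dec incident? G u e) (e∈M , u∼e)))))
        (≤-sum (live-endpoint e) u)

  enforcer-gain-scaled : ∀ {A F M g} → g ≤ d → (∀ u → Live A u → freeDegree F u ≤ g) →
    Covered A F → M ⊆ F → q ≤ ∣ M ∣ → q * potential A F + q * weight g ≤ q * potential A (F ─ M)
  enforcer-gain-scaled {A} {F} {M} {g} g≤d F≤g covered M⊆F q≤∣M∣ = begin
    q * potential A F + q * weight g                      ≤⟨ +-monoʳ-≤ _ (*-monoˡ-≤ (weight g) q≤∑k) ⟩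
    q * potential A F + (∑[ u < n ] (χ u * k u)) * weight g ≡⟨ regroup ⟩
    ∑[ u < n ] (χ u * (q * weight (freeDegree F u) + k u * weight g))
                                                          ≤⟨ sum-mono-≤ (λ u → 𝟙*-mono (live? A u) (gain u)) ⟩
    ∑[ u < n ] (χ u * (q * weight (j u)))                 ≡⟨ regroup′ ⟩
    q * potential A (F ─ M)                               ∎
    where
    open ≤-Reasoning
    χ : Fin n → ℕ
    χ u = 𝟙 (live? A u)
    j k : Fin n → ℕ
    j = freeDegree (F ─ M)
    k = freeDegree M
    q≤∑k : q ≤ ∑[ u < n ] (χ u * k u)
    q≤∑k = ≤-trans q≤∣M∣ (covered⇒∣M∣≤ M⊆F covered)
    gain : ∀ u → Live A u → q * weight (freeDegree F u) + k u * weight g ≤ q * weight (j u)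
    gain u u-live = begin
      q * weight (freeDegree F u) + k u * weight g ≤⟨ +-monoˡ-≤ _ (*-monoʳ-≤ q
                                                         (weight-antitone (freeDegree-─ M⊆F u) (freeDegree≤d F u))) ⟩
      q * weight (j u + k u) + k u * weight g      ≤⟨ weight-gain (j u) (k u)
                                                         (≤-trans (freeDegree-─ M⊆F u) (F≤g u u-live)) g≤d ⟩
      q * weight (j u)                             ∎
    regroup : q * potential A F + (∑[ u < n ] (χ u * k u)) * weight g
            ≡ ∑[ u < n ] (χ u * (q * weight (freeDegree F u) + k u * weight g))
    regroup = begin-equality
      q * potential A F + (∑[ u < n ] (χ u * k u)) * weight g
        ≡⟨ cong₂ _+_ (*-distribˡ-sum q (λ u → χ u * weight (freeDegree F u)))
                     (*-distribʳ-sum (weight g) (λ u → χ u * k u)) ⟩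
      ∑[ u < n ] (q * (χ u * weight (freeDegree F u))) + ∑[ u < n ] (χ u * k u * weight g)
        ≡⟨ ∑-distrib-+ (λ u → q * (χ u * weight (freeDegree F u))) (λ u → χ u * k u * weight g) ⟨
      ∑[ u < n ] (q * (χ u * weight (freeDegree F u)) + χ u * k u * weight g)
        ≡⟨ sum-cong-≗ (λ u → solve 5 (λ x Q w y z → Q :* (x :* w) :+ x :* y :* z := x :* (Q :* w :+ y :* z))
                                     refl (χ u) q (weight (freeDegree F u)) (k u) (weight g)) ⟩
      ∑[ u < n ] (χ u * (q * weight (freeDegree F u) + k u * weight g)) ∎
    regroup′ : ∑[ u < n ] (χ u * (q * weight (j u))) ≡ q * potential A (F ─ M)
    regroup′ = trans (sum-cong-≗ λ u → solve 3 (λ x Q w → x :* (Q :* w) := Q :* (x :* w))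
                                               refl (χ u) q (weight (j u)))
                     (sym (*-distribˡ-sum q (λ u → χ u * weight (j u))))

  enforcer-gain : ∀ {A F M g} → 1 ≤ g → g ≤ d → (∀ u → Live A u → freeDegree F u ≤ g) →
    Covered A F → M ⊆ F → q ≤ ∣ M ∣ → potential A F + weight g ≤ potential A (F ─ M)
  enforcer-gain {A} {F} {M} {g} 1≤g g≤d F≤g covered M⊆F q≤∣M∣ with q ≟ℕ 0
  ... | yes q≡0 = begin
    potential A F + weight g   ≡⟨ cong (potential A F +_) (weight≡0 q≡0 1≤g) ⟩
    potential A F + 0          ≡⟨ +-identityʳ _ ⟩
    potential A F              ≤⟨ potential-antitone A (p─q⊆p F M) ⟩
    potential A (F ─ M)        ∎
    where open ≤-Reasoning
  ... | no  q≢0 = *-cancelˡ-≤ q {{≢-nonZero q≢0}}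
    (≤-trans (≤-reflexive (*-distribˡ-+ q _ _)) (enforcer-gain-scaled g≤d F≤g covered M⊆F q≤∣M∣))

  OtherLive : Subset m → Fin n → Fin n → Set
  OtherLive A v u = Live A u × u ≢ v

  otherLive? : ∀ A v u → Dec (OtherLive A v u)
  otherLive? A v u = live? A u ×-dec ¬? (u ≟ v)

  Blocked : Subset m → Fin n → Fin m → Set
  Blocked A v e = OtherLive A v (proj₁ (ends e)) ⊎ OtherLive A v (proj₂ (ends e))

  blocked? : ∀ A v e → Dec (Blocked A v e)
  blocked? A v e = otherLive? A v (proj₁ (ends e)) ⊎-dec otherLive? A v (proj₂ (ends e))

  blocked : ∀ {A v u e} → OtherLive A v u → Incident G u e → Blocked A v e
  blocked other (inj₁ refl) = inj₁ other
  blocked other (inj₂ refl) = inj₂ other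

  live-not-blocked : ∀ {A v e} → Live A v → Incident G v e → ¬ Blocked A v e
  live-not-blocked _         (inj₁ refl) (inj₁ (_ , a≢v))          = a≢v refl
  live-not-blocked (v∈I , _) (inj₁ refl) (inj₂ ((b∈I , _) , _)) = I-independent _ v∈I b∈I
  live-not-blocked (v∈I , _) (inj₂ refl) (inj₁ ((a∈I , _) , _)) = I-independent _ a∈I v∈I
  live-not-blocked _         (inj₂ refl) (inj₂ (_ , b≢v))          = b≢v refl

  movable? : ∀ A F v e → Dec (e ∈ F × ¬ Blocked A v e)
  movable? A F v e = e ∈? F ×-dec ¬? (blocked? A v e)

  avoiderMove : Subset m → Subset m → Fin n → Subset m
  avoiderMove A F v = subset (movable? A F v)

  avoiderMove⊆ : ∀ {A F v} → avoiderMove A F v ⊆ F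
  avoiderMove⊆ {A} {F} {v} e∈M = proj₁ (∈-subset⁻ (movable? A F v) e∈M)

  ∈avoiderMove : ∀ {A F v e} → Live A v → e ∈ F → Incident G v e → e ∈ avoiderMove A F v
  ∈avoiderMove {A} {F} {v} v-live e∈F v∼e = ∈-subset⁺ (movable? A F v) (e∈F , live-not-blocked v-live v∼e)

  live-after-move : ∀ {A F v u} → Live A u → u ≢ v → Live (A ∪ avoiderMove A F v) u
  live-after-move {A} {F} {v} {u} u-live@(u∈I , untouched) u≢v = u∈I , untouched′
    where
    untouched′ : Untouched (A ∪ avoiderMove A F v) u
    untouched′ e e∈A∪M u∼e with x∈p∪q⁻ A (avoiderMove A F v) e∈A∪M
    ... | inj₁ e∈A = untouched e e∈A u∼e
    ... | inj₂ e∈M = proj₂ (∈-subset⁻ (movable? A F v) e∈M) (blocked (u-live , u≢v) u∼e)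

  covered-after-move : ∀ {A F v} → Covered (A ∪ avoiderMove A F v) (F ─ avoiderMove A F v)
  covered-after-move {A} {F} {v} {e} e∈F─M with blocked? A v e
  ... | yes (inj₁ (a-live , a≢v)) = proj₁ (ends e) , live-after-move a-live a≢v , inj₁ refl
  ... | yes (inj₂ (b-live , b≢v)) = proj₂ (ends e) , live-after-move b-live b≢v , inj₂ refl
  ... | no  ¬blocked = contradiction (∈-subset⁺ (movable? A F v) (p─q⊆p F M e∈F─M , ¬blocked)) (x∈p─q⇒x∉q F M e∈F─M)
    where M = avoiderMove A F v

  potential-after-move : ∀ {A F v} →
    potential A F ≤ potential (A ∪ avoiderMove A F v) (F ─ avoiderMove A F v) + weight (freeDegree F v)
  potential-after-move {A} {F} {v} = begin
    potential A F                                 ≤⟨ sum-mono-≤ pointwise ⟩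
    ∑[ u < n ] (after u + at-v u)                 ≡⟨ ∑-distrib-+ after at-v ⟩
    potential A′ F′ + ∑[ u < n ] at-v u           ≡⟨ cong (potential A′ F′ +_) only-v ⟩
    potential A′ F′ + weight (freeDegree F v)     ∎
    where
    open ≤-Reasoning
    M = avoiderMove A F v
    A′ = A ∪ M
    F′ = F ─ M
    after at-v : Fin n → ℕ
    after u = 𝟙 (live? A′ u) * weight (freeDegree F′ u)
    at-v u = 𝟙 (u ≟ v) * weight (freeDegree F v)
    only-v : ∑[ u < n ] at-v u ≡ weight (freeDegree F v)
    only-v = trans (sym (*-distribʳ-sum (weight (freeDegree F v)) (λ u → 𝟙 (u ≟ v))))
                   (trans (cong (_* weight (freeDegree F v)) (∑𝟙[≟] v)) (*-identityˡ _))
    pointwise : ∀ u → 𝟙 (live? A u) * weight (freeDegree F u) ≤ after u + at-v u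
    pointwise u with u ≟ v
    ... | yes refl = ≤-trans (*-monoˡ-≤ (weight (freeDegree F u)) (𝟙≤1 (live? A u))) (m≤n+m _ (after u))
    ... | no  u≢v  = ≤-trans
      (*-mono-≤ (𝟙-mono (live? A u) (live? A′ u) (λ u-live → live-after-move u-live u≢v))
                (weight-antitone (freeDegree-mono (p─q⊆p F M) u) (freeDegree≤d F u)))
      (m≤m+n _ _)

  potential-initial : ∣ I ∣ * q ^ d ≤ potential ⊥ ⊤
  potential-initial = begin
    ∣ I ∣ * q ^ d                      ≡⟨ cong (_* q ^ d) (∣p∣≡∑𝟙[∈] I) ⟩
    (∑[ u < n ] 𝟙 (u ∈? I)) * q ^ d    ≡⟨ *-distribʳ-sum (q ^ d) (λ u → 𝟙 (u ∈? I)) ⟩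
    ∑[ u < n ] (𝟙 (u ∈? I) * q ^ d)    ≤⟨ sum-mono-≤ (λ u → *-mono-≤ (𝟙-mono (u ∈? I) (live? ⊥ u) live-at-start)
                                                                    (q^d≤weight (freeDegree≤d ⊤ u))) ⟩
    potential ⊥ ⊤                      ∎
    where
    open ≤-Reasoning
    live-at-start : ∀ {u} → u ∈ I → Live ⊥ u
    live-at-start u∈I = u∈I , λ _ e∈⊥ → contradiction e∈⊥ ∉⊥

  record EnforcerInvariant (A F : Subset m) : Set where
    field
      bound            : ℕ
      1≤bound          : 1 ≤ bound
      bound≤d          : bound ≤ d
      freeDegree≤bound : ∀ u → Live A u → freeDegree F u ≤ bound
      covered          : Covered A F
      potential-bound  : suc q ^ d ≤ potential A F + weight bound

  invariant⇒live : ∀ {A F} → EnforcerInvariant A F → ∃ (Live A)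
  invariant⇒live {A} {F} inv = potential>0⇒live A F (+-cancelʳ-< (weight bound) 0 (potential A F)
    (<-≤-trans (weight<suc[q]^d 1≤bound bound≤d) potential-bound))
    where open EnforcerInvariant inv

  invariant-after-move : ∀ {A F v} → Live A v → (∀ u → Live A u → freeDegree F u ≤ freeDegree F v) →
    1 ≤ freeDegree F v → suc q ^ d ≤ potential A F →
    EnforcerInvariant (A ∪ avoiderMove A F v) (F ─ avoiderMove A F v)
  invariant-after-move {A} {F} {v} v-live v-max 1≤deg start = record
    { bound            = freeDegree F v
    ; 1≤bound          = 1≤deg
    ; bound≤d          = freeDegree≤d F v
    ; freeDegree≤bound = λ u u-live →
        ≤-trans (freeDegree-mono (p─q⊆p F _) u) (v-max u (live-∪⁻ (avoiderMove A F v) u-live))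
    ; covered          = covered-after-move
    ; potential-bound  = ≤-trans start potential-after-move
    }

  invariant-after-enforcer : ∀ {A F M} → EnforcerInvariant A F → LegalMove G q F M →
    Nonempty (F ─ M) → suc q ^ d ≤ potential A (F ─ M)
  invariant-after-enforcer {F = F} inv (M⊆F , legal) F─M≠∅ = ≤-trans potential-bound
    (enforcer-gain 1≤bound bound≤d freeDegree≤bound covered M⊆F (a⊓∣p∣≤∣q∣⇒a≤∣q∣ q M⊆F F─M≠∅ legal))
    where open EnforcerInvariant inv

  avoiderWins : ∀ k A F → ∣ F ∣ < k → suc q ^ d ≤ potential A F → AvoiderTurnWin G 1 q A F
  enforcerLoses : ∀ k A F → ∣ F ∣ < k → EnforcerInvariant A F → EnforcerTurnWin G 1 q A F

  avoiderWins (suc k) A F ∣F∣≤k start with potential>0⇒live A F (<-≤-trans (m^n>0 (suc q) d) start)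
  ... | some-live with nonempty? F
  ...   | no  F-empty    = a-end F-empty (live⇒goal some-live)
  ...   | yes F-nonempty with argmax (live? A) (freeDegree F) some-live
  ...     | v , v-live , v-max with 1 ≤? freeDegree F v
  ...       | no  deg<1 = a-move F-nonempty F (id , m⊓n≤n 1 ∣ F ∣) (e-end nothing-left (v , untouched))
    where
    nothing-left : Empty (F ─ F)
    nothing-left (e , e∈F─F) = x∈p─q⇒x∉q F F e∈F─F (p─q⊆p F F e∈F─F)
    untouched : Untouched (A ∪ F) v
    untouched e e∈A∪F with x∈p∪q⁻ A F e∈A∪F
    ... | inj₁ e∈A = proj₂ v-live e e∈A
    ... | inj₂ e∈F = freeDegree<1 (≰⇒> deg<1) e∈F
  ...       | yes 1≤deg = a-move F-nonempty M (avoiderMove⊆ , ≤-trans (m⊓n≤m 1 ∣ F ∣) (x∈p⇒0<∣p∣ M e∈M))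
                (enforcerLoses k (A ∪ M) (F ─ M) (<-≤-trans shrinks (≤-pred ∣F∣≤k))
                  (invariant-after-move v-live v-max 1≤deg start))
    where
    M = avoiderMove A F v
    free-edge-at-v = freeDegree>0 {F} {v} 1≤deg
    e = proj₁ free-edge-at-v
    e∈F = proj₁ (proj₂ free-edge-at-v)
    e∈M : e ∈ M
    e∈M = ∈avoiderMove v-live e∈F (proj₂ (proj₂ free-edge-at-v))
    shrinks : ∣ F ─ M ∣ < ∣ F ∣
    shrinks = p∩q≢∅⇒∣p─q∣<∣p∣ F M (e , x∈p∩q⁺ (e∈F , e∈M))

  enforcerLoses k A F ∣F∣<k inv with nonempty? F
  ... | no  F-empty    = e-end F-empty (live⇒goal (invariant⇒live inv))
  ... | yes F-nonempty = e-move F-nonempty respond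
    where
    respond : ∀ M → LegalMove G q F M → AvoiderTurnWin G 1 q A (F ─ M)
    respond M legal with nonempty? (F ─ M)
    ... | no  F─M-empty    = a-end F─M-empty (live⇒goal (invariant⇒live inv))
    ... | yes F─M-nonempty = avoiderWins k A (F ─ M) (≤-<-trans (∣p─q∣≤∣p∣ F M) ∣F∣<k)
                                         (invariant-after-enforcer inv legal F─M-nonempty)

corollary1p11 : (n : ℕ) (G : Graph n) (d : ℕ) →
    MaxDegree G d → 2 * d + 2 < n →
    (q : ℕ) → LnCondition n d q →
    AvoiderCanIsolateVertex G 1 q
corollary1p11 n G d (deg≤d , _) 2d+2<n q ln with independent-set G deg≤d
... | I , I-independent , n≤[2d+1]∣I∣ =
  avoiderWins (suc ∣ ⊤ {Graph.m G} ∣) ⊥ ⊤ ≤-refl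
    (≤-trans (lnCondition⇒suc[q]^d≤c*q^d 2d+2<n ln n≤[2d+1]∣I∣) potential-initial)
  where open AvoiderStrategy G deg≤d q I-independent
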